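{- Let $G>I$ be a finite group with trivial center and let $\sigma_1,\sigma_2\in G$ with $G=\langle\sigma_1,\sigma_2\rangle$ and $o(\sigma_1\sigma_2)=2$. Then: (a) For $e_1=[\sigma_1,\sigma_1,\sigma_2,\sigma_1\sigma_2\sigma_1^{ -1}]$ and $e_2=e_1^{\beta_{13}}=[\sigma_1,\sigma_2\sigma_1\sigma_2^{ -1},\sigma_2,\sigma_2]$, the set $Z_1=\{e_1,e_2\}$ is an orbit of length $2$ under $B_4$, on which $\rho_4(\beta_{12})$ is the identity, $\rho_4(\beta_{13})$ and $\rho_4(\beta_{14})$ both interchange $e_1,e_2$, $\rho_4(B_4)\cong C_2$, and $g_{Z_1}=0$. (b) For $e_3=[\sigma_1,\sigma_2,\sigma_1,\sigma_2]$ and $e_4=e_3^{\beta_{12}}=[\sigma_1,\sigma_2,\sigma_2^{ -1}\sigma_1\sigma_2,\sigma_1\sigma_2\sigma_1^{ -1}]$, the set $Z_2=\{e_3,e_4\}$ is an orbit of length $2$ under $B_4$, on which $\rho_4(\beta_{12})$ and $\rho_4(\beta_{14})$ interchange $e_3,e_4$, $\rho_4(\beta_{13})$ is the identity, $\rho_4(B_4)\cong C_2$, and $g_{Z_2}=0$. (c) For $e_5=[\sigma_1,\sigma_2,\sigma_2,\sigma_2^{ -1}\sigma_1\sigma_2]$ and $e_6=e_5^{\beta_{12}}=[\sigma_1,\sigma_2,\sigma_1\sigma_2\sigma_1^{ -1},\sigma_1]$, the set $Z_3=\{e_5,e_6\}$ is an orbit of length $2$ under $B_4$, on which $\rho_4(\beta_{12})$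 and $\rho_4(\beta_{13})$ interchange $e_5,e_6$, $\rho_4(\beta_{14})$ is the identity, $\rho_4(B_4)\cong C_2$, and $g_{Z_3}=0$.
   Context: For a finite group $G$ with identity $\iota$, a generating $4$-system is $(\sigma_1,\dots,\sigma_4)\in G^4$ with $\langle\sigma_1,\dots,\sigma_4\rangle=G$ and $\sigma_1\sigma_2\sigma_3\sigma_4=\iota$; $[\sigma_1,\dots,\sigma_4]$ denotes its class modulo simultaneous conjugation by $G$. The pure Hurwitz braid group $B_4$ is generated by $\beta_{12},\beta_{13},\beta_{14}$ (and $\beta_{23},\beta_{24},\beta_{34}$) and acts on the right on classes of generating $4$-systems with given classes $C_1,\dots,C_4$ by $[\underline\sigma]^{\beta_{12}}=[(\sigma_3\sigma_4)^{ -1}\sigma_1(\sigma_3\sigma_4),(\sigma_3\sigma_4)^{ -1}\sigma_2(\sigma_3\sigma_4),\sigma_3,\sigma_4]$, $[\underline\sigma]^{\beta_{13}}=[(\sigma_2\sigma_4)^{ -1}\sigma_1(\sigma_2\sigma_4),\sigma_2,(\sigma_4\sigma_2)^{ -1}\sigma_3(\sigma_4\sigma_2),\sigma_4]$, $[\underline\sigma]^{\beta_{14}}=[(\sigma_2\sigma_3)^{ -1}\sigma_1(\sigma_2\sigma_3),\sigma_2,\sigma_3,(\sigma_2\sigma_3)^{ -1}\sigma_4(\sigma_2\sigma_3)]$ (these are the actions of $\beta_{12}=\beta_2^2$, $\beta_{13}=\beta_2^{ -1}\beta_3^2\beta_2$, $\beta_{14}=\beta_2^{ -1}\beta_3^{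 -1}\beta_4^2\beta_3\beta_2$ in the Hurwitz braid group $H_4$, which acts by $[\underline\sigma]^{\beta_i}=[\dots,\sigma_{i-1}\sigma_i\sigma_{i-1}^{ -1},\sigma_{i-1},\dots]$). $\rho_4$ denotes the induced permutation representation on the orbit. For a $B_4$-orbit $Z$, with $z_{1j}$ the number of cycles (including fixed points) of $\rho_4(\beta_{1j})$ on $Z$, the genus is $g_Z=1-|Z|+\frac12(3|Z|-z_{12}-z_{13}-z_{14})$. -}

module Defs where

open import Level using (Level; _⊔_)
open import Algebra.Bundles using (Group)
open import Data.Fin using (Fin; zero; suc; toℕ)
open import Data.Nat as ℕ using (ℕ; _≤_)
open import Data.Nat.Properties using (_≤?_)
open import Data.Integer as ℤ using (ℤ)
open import Data.List using (List; filter; length; allFin; upTo)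
open import Data.List.Relation.Unary.Any using (Any)
open import Data.List.Relation.Unary.All using (All)
open import Data.List.Relation.Unary.All using (all?)
open import Data.Product using (Σ; _×_; _,_; ∃)
open import Data.Sum using (_⊎_)
open import Function using (_∘_; id)
open import Relation.Nullary using (¬_)
open import Relation.Unary using (Decidable)
open import Relation.Binary.PropositionalEquality using (_≡_)
open import Relation.Binary.Construct.Closure.Equivalence using (EqClosure)

iter : ∀ {n} → (Fin n → Fin n) → ℕ → Fin n → Fin n
iter p ℕ.zero    i = i
iter p (ℕ.suc k) i = p (iter p k i)

CycleMin : ∀ {n} (p : Fin n → Fin n) (i : Fin n) → Set
CycleMin {n} p i = All (λ k → toℕ i ≤ toℕ (iter p k i)) (upTo (ℕ.suc n))

cycleMin? : ∀ {n} (p : Fin n → Fin n) → Decidable (CycleMin p)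
cycleMin? {n} p i = all? (λ k → toℕ i ≤? toℕ (iter p k i)) (upTo (ℕ.suc n))

-- number of cycles (fixed points included) of a permutation p of Fin n
cycles : ∀ {n} → (Fin n → Fin n) → ℕ
cycles {n} p = length (filter (cycleMin? p) (allFin n))

_≗ₚ_ : ∀ {n} → (Fin n → Fin n) → (Fin n → Fin n) → Set
p ≗ₚ q = ∀ i → p i ≡ q i

swap2 : Fin 2 → Fin 2
swap2 zero       = suc zero
swap2 (suc zero) = zero

-- the permutation group generated by p₁₂, p₁₃, p₁₄ (finite, so the
-- generated monoid is the generated group)
data InGen {n} (p₁₂ p₁₃ p₁₄ : Fin n → Fin n) : (Fin n → Fin n) → Set where
  gen-id : InGen p₁₂ p₁₃ p₁₄ id
  gen-12 : ∀ {q} → InGen p₁₂ p₁₃ p₁₄ q → InGen p₁₂ p₁₃ p₁₄ (p₁₂ ∘ q)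
  gen-13 : ∀ {q} → InGen p₁₂ p₁₃ p₁₄ q → InGen p₁₂ p₁₃ p₁₄ (p₁₃ ∘ q)
  gen-14 : ∀ {q} → InGen p₁₂ p₁₃ p₁₄ q → InGen p₁₂ p₁₃ p₁₄ (p₁₄ ∘ q)

-- ρ₄(B₄) ≅ C₂ for an orbit of length 2 : the image is exactly {id, swap}
-- (a group of order 2 is cyclic of order 2)
ImageIsC₂ : (p₁₂ p₁₃ p₁₄ : Fin 2 → Fin 2) → Set
ImageIsC₂ p₁₂ p₁₃ p₁₄ =
  (∀ q → InGen p₁₂ p₁₃ p₁₄ q → (q ≗ₚ id) ⊎ (q ≗ₚ swap2))
  × (Σ (Fin 2 → Fin 2) λ q → InGen p₁₂ p₁₃ p₁₄ q × (q ≗ₚ swap2))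

-- 2 · g_Z  where  g_Z = 1 - |Z| + (3|Z| - z₁₂ - z₁₃ - z₁₄)/2
twiceGenus : (Z z₁₂ z₁₃ z₁₄ : ℕ) → ℤ
twiceGenus Z z₁₂ z₁₃ z₁₄ =
  ℤ.+ 2 ℤ.- ℤ.+ (2 ℕ.* Z) ℤ.+ ℤ.+ (3 ℕ.* Z) ℤ.- ℤ.+ z₁₂ ℤ.- ℤ.+ z₁₃ ℤ.- ℤ.+ z₁₄

module _ {c ℓ : Level} (G : Group c ℓ) where
  open Group G

  Finite : Set (c ⊔ ℓ)
  Finite = Σ (List Carrier) λ xs → ∀ x → Any (x ≈_) xs

  Nontrivial : Set (c ⊔ ℓ)
  Nontrivial = Σ Carrier λ x → ¬ (x ≈ ε)

  TrivialCenter : Set (c ⊔ ℓ)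
  TrivialCenter = ∀ z → (∀ x → z ∙ x ≈ x ∙ z) → z ≈ ε

  HasOrder2 : Carrier → Set ℓ
  HasOrder2 x = (¬ (x ≈ ε)) × (x ∙ x ≈ ε)

  data ⟨_⟩ (S : Carrier → Set ℓ) : Carrier → Set (c ⊔ ℓ) where
    gen  : ∀ {x} → S x → ⟨ S ⟩ x
    unit : ⟨ S ⟩ ε
    mul  : ∀ {x y} → ⟨ S ⟩ x → ⟨ S ⟩ y → ⟨ S ⟩ (x ∙ y)
    inv  : ∀ {x} → ⟨ S ⟩ x → ⟨ S ⟩ (x ⁻¹)
    resp : ∀ {x y} → x ≈ y → ⟨ S ⟩ x → ⟨ S ⟩ y

  Generates : (Carrier → Set ℓ) → Set (c ⊔ ℓ)
  Generates S = ∀ x → ⟨ S ⟩ x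

  Gen2 : Carrier → Carrier → Carrier → Set ℓ
  Gen2 a b x = (x ≈ a) ⊎ (x ≈ b)

  record Sys : Set c where
    constructor ⟦_,_,_,_⟧
    field s₁ s₂ s₃ s₄ : Carrier
  open Sys public

  Gen4 : Sys → Carrier → Set ℓ
  Gen4 t x = (x ≈ s₁ t) ⊎ (x ≈ s₂ t) ⊎ (x ≈ s₃ t) ⊎ (x ≈ s₄ t)

  IsGenSys : Sys → Set (c ⊔ ℓ)
  IsGenSys t = Generates (Gen4 t) × (((s₁ t ∙ s₂ t) ∙ s₃ t) ∙ s₄ t ≈ ε)

  _^_ : Carrier → Carrier → Carrier
  x ^ g = (g ⁻¹ ∙ x) ∙ g

  -- equality of classes modulo simultaneous conjugation
  Conj : Sys → Sys → Set (c ⊔ ℓ)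
  Conj t u = Σ Carrier λ g →
    (s₁ u ≈ s₁ t ^ g) × (s₂ u ≈ s₂ t ^ g) × (s₃ u ≈ s₃ t ^ g) × (s₄ u ≈ s₄ t ^ g)

  act₁₂ : Sys → Sys
  act₁₂ ⟦ a , b , c' , d ⟧ = ⟦ a ^ (c' ∙ d) , b ^ (c' ∙ d) , c' , d ⟧

  act₁₃ : Sys → Sys
  act₁₃ ⟦ a , b , c' , d ⟧ = ⟦ a ^ (b ∙ d) , b , c' ^ (d ∙ b) , d ⟧

  act₁₄ : Sys → Sys
  act₁₄ ⟦ a , b , c' , d ⟧ = ⟦ a ^ (b ∙ c') , b , c' , d ^ (b ∙ c') ⟧

  -- one generator step of B₄ = ⟨β₁₂, β₁₃, β₁₄⟩, or passing to another
  -- representative of the same class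
  data Step : Sys → Sys → Set (c ⊔ ℓ) where
    st-conj : ∀ {t u} → Conj t u → Step t u
    st-12   : ∀ t → Step t (act₁₂ t)
    st-13   : ∀ t → Step t (act₁₃ t)
    st-14   : ∀ t → Step t (act₁₄ t)

  SameOrbit : Sys → Sys → Set (c ⊔ ℓ)
  SameOrbit = EqClosure Step

  Induces : (Sys → Sys) → (Fin 2 → Sys) → (Fin 2 → Fin 2) → Set (c ⊔ ℓ)
  Induces act e p = ∀ i → Conj (act (e i)) (e (p i))

  OrbitClaim : (e : Fin 2 → Sys) (p₁₂ p₁₃ p₁₄ : Fin 2 → Fin 2) → Set (c ⊔ ℓ)
  OrbitClaim e p₁₂ p₁₃ p₁₄ =
    (∀ i → IsGenSys (e i))
    × ¬ Conj (e zero) (e (suc zero))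
    × SameOrbit (e zero) (e (suc zero))
    × (∀ t → SameOrbit (e zero) t → Conj t (e zero) ⊎ Conj t (e (suc zero)))
    × Induces act₁₂ e p₁₂ × Induces act₁₃ e p₁₃ × Induces act₁₄ e p₁₄
    × ImageIsC₂ p₁₂ p₁₃ p₁₄
    × twiceGenus 2 (cycles p₁₂) (cycles p₁₃) (cycles p₁₄) ≡ ℤ.+ 0

  pair : Sys → Sys → Fin 2 → Sys
  pair a b zero       = a
  pair a b (suc zero) = b

{-# OPTIONS --safe #-}

-- All claims about e₁,…,e₆ reduce to identities between words in σ₁, σ₂.  Writing
-- τ = σ₁σ₂, so that σ₂ = σ₁⁻¹τ and τ² = 1, each such word is a word in σ₁^±1 and τ, and
-- the identities needed (each eᵢ is a generating system, and β₁₂, β₁₃, β₁₄ send eᵢ to a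
-- conjugate of some eⱼ by an explicit conjugator) hold because both sides have the same
-- free reduction with τ self-inverse.  As the β₁ⱼ permute the two classes of a pair, the
-- pair is a whole B₄-orbit.  The two classes are distinct: a simultaneous conjugator
-- fixes σ₁ and σ₂, so it is central, hence trivial, and the remaining entries would then
-- force σ₁σ₂ = σ₂σ₁, making the involution σ₁σ₂ central.

module Submission where

open import Defs hiding (_^_)
open import Level using (Level)
open import Algebra.Bundles using (Group)
open import Data.Product using (_×_; _,_; Σ; proj₁; proj₂)
open import Function using (id; _∘_)
open import Data.Nat using (ℕ; suc)
open import Data.Fin using (Fin; zero; suc)
open import Data.Fin.Properties using () renaming (_≟_ to _≟ᶠ_)
open import Data.List using (List; []; _∷_; _++_)
open import Data.Vec using (Vec; []; _∷_; lookup)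
open import Data.Sum using (_⊎_; inj₁; inj₂)
open import Relation.Binary.Definitions using (DecidableEquality)
open import Relation.Binary.PropositionalEquality using (_≡_; refl; cong; subst)
import Relation.Binary.PropositionalEquality as ≡
open import Relation.Nullary using (¬_; yes; no)
open import Relation.Nullary.Decidable using (map′)
open import Relation.Binary.Construct.Closure.ReflexiveTransitive using (_◅_) renaming (ε to []*)
open import Relation.Binary.Construct.Closure.Symmetric using (fwd; bwd)
import Algebra.Properties.Group as GroupProperties
import Relation.Binary.Reasoning.Setoid as SetoidReasoning

module _ {c ℓ} (G : Group c ℓ) where
  open Group G renaming (refl to ≈-refl)

  module Reduction {a} {A : Set a} (_≟_ : DecidableEquality A) (bar : A → A) (val : A → Carrier)
    (val-bar : ∀ x → val x ∙ val (bar x) ≈ ε) where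

    open GroupProperties G
    open SetoidReasoning setoid

    eval : List A → Carrier
    eval []      = ε
    eval (x ∷ w) = val x ∙ eval w

    invert : List A → List A
    invert []      = []
    invert (x ∷ w) = invert w ++ bar x ∷ []

    cons↓ : A → List A → List A
    cons↓ x []      = x ∷ []
    cons↓ x (y ∷ w) with y ≟ bar x
    ... | yes _ = w
    ... | no  _ = x ∷ y ∷ w

    reduce : List A → List A
    reduce []      = []
    reduce (x ∷ w) = cons↓ x (reduce w)

    val-bar≈⁻¹ : ∀ x → val (bar x) ≈ val x ⁻¹
    val-bar≈⁻¹ x = inverseʳ-unique (val x) (val (bar x)) (val-bar x)

    eval-++ : ∀ w v → eval (w ++ v) ≈ eval w ∙ eval v
    eval-++ []      v = sym (identityˡ _)
    eval-++ (x ∷ w) v = trans (∙-congˡ (eval-++ w v)) (sym (assoc _ _ _))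

    eval-invert : ∀ w → eval (invert w) ≈ eval w ⁻¹
    eval-invert []      = sym ε⁻¹≈ε
    eval-invert (x ∷ w) = begin
      eval (invert w ++ bar x ∷ [])     ≈⟨ eval-++ (invert w) _ ⟩
      eval (invert w) ∙ (val (bar x) ∙ ε) ≈⟨ ∙-cong (eval-invert w) (trans (identityʳ _) (val-bar≈⁻¹ x)) ⟩
      eval w ⁻¹ ∙ val x ⁻¹               ≈⟨ sym (⁻¹-anti-homo-∙ (val x) (eval w)) ⟩
      (val x ∙ eval w) ⁻¹                ∎

    eval-cons↓ : ∀ x w → eval (cons↓ x w) ≈ val x ∙ eval w
    eval-cons↓ x []      = ≈-refl
    eval-cons↓ x (y ∷ w) with y ≟ bar x
    ... | yes refl = begin
      eval w                             ≈⟨ sym (identityˡ _) ⟩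
      ε ∙ eval w                         ≈⟨ ∙-congʳ (sym (val-bar x)) ⟩
      (val x ∙ val (bar x)) ∙ eval w     ≈⟨ assoc _ _ _ ⟩
      val x ∙ (val (bar x) ∙ eval w)     ∎
    ... | no  _ = ≈-refl

    eval-reduce : ∀ w → eval (reduce w) ≈ eval w
    eval-reduce []      = ≈-refl
    eval-reduce (x ∷ w) = trans (eval-cons↓ x (reduce w)) (∙-congˡ (eval-reduce w))

    reduce-≡⇒eval-≈ : ∀ w v → reduce w ≡ reduce v → eval w ≈ eval v
    reduce-≡⇒eval-≈ w v eq = begin
      eval w          ≈⟨ sym (eval-reduce w) ⟩
      eval (reduce w) ≡⟨ cong eval eq ⟩
      eval (reduce v) ≈⟨ eval-reduce v ⟩
      eval v          ∎

-- Letters of the free product of the free group on m generators with ⟨τ ∣ τ²⟩.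
data Letter (m : ℕ) : Set where
  gen⁺ gen⁻ : Fin m → Letter m
  τ         : Letter m

module _ {m : ℕ} where

  _≟ˡ_ : DecidableEquality (Letter m)
  gen⁺ i ≟ˡ gen⁺ j = map′ (cong gen⁺) (λ { refl → refl }) (i ≟ᶠ j)
  gen⁻ i ≟ˡ gen⁻ j = map′ (cong gen⁻) (λ { refl → refl }) (i ≟ᶠ j)
  τ      ≟ˡ τ      = yes refl
  gen⁺ _ ≟ˡ gen⁻ _ = no λ ()
  gen⁺ _ ≟ˡ τ      = no λ ()
  gen⁻ _ ≟ˡ gen⁺ _ = no λ ()
  gen⁻ _ ≟ˡ τ      = no λ ()
  τ      ≟ˡ gen⁺ _ = no λ ()
  τ      ≟ˡ gen⁻ _ = no λ ()

  bar : Letter m → Letter m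
  bar (gen⁺ i) = gen⁻ i
  bar (gen⁻ i) = gen⁺ i
  bar τ        = τ

data Expr (n : ℕ) : Set where
  var  : Fin n → Expr n
  εᵉ   : Expr n
  _∙ᵉ_ : Expr n → Expr n → Expr n
  _⁻¹ᵉ : Expr n → Expr n

infixl 7 _∙ᵉ_
infix  8 _⁻¹ᵉ
infixl 9 _^ᵉ_

_^ᵉ_ : ∀ {n} → Expr n → Expr n → Expr n
x ^ᵉ g = (g ⁻¹ᵉ ∙ᵉ x) ∙ᵉ g

v₀ : ∀ {n} → Expr (suc n)
v₀ = var zero

v₁ : ∀ {n} → Expr (suc (suc n))
v₁ = var (suc zero)

v₂ : ∀ {n} → Expr (suc (suc (suc n)))
v₂ = var (suc (suc zero))

v₃ : ∀ {n} → Expr (suc (suc (suc (suc n))))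
v₃ = var (suc (suc (suc zero)))

-- A variable may stand for a longer word, so that relations among the variables are
-- visible to the reduction.
module _ {c ℓ} (G : Group c ℓ) where
  open Group G renaming (refl to ≈-refl)

  module Solver {m} (gen : Fin m → Carrier) (involution : Carrier) (involution² : involution ∙ involution ≈ ε)
    {n} (ρ : Fin n → Carrier) (word : Fin n → List (Letter m))
    where

    letter : Letter m → Carrier
    letter (gen⁺ i) = gen i
    letter (gen⁻ i) = gen i ⁻¹
    letter τ        = involution

    letter-bar : ∀ x → letter x ∙ letter (bar x) ≈ ε
    letter-bar (gen⁺ i) = inverseʳ (gen i)
    letter-bar (gen⁻ i) = inverseˡ (gen i)
    letter-bar τ        = involution²

    open Reduction G _≟ˡ_ bar letter letter-bar public

    ⟦_⟧ᵉ : Expr n → Carrier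
    ⟦ var i  ⟧ᵉ = ρ i
    ⟦ εᵉ     ⟧ᵉ = ε
    ⟦ e ∙ᵉ f ⟧ᵉ = ⟦ e ⟧ᵉ ∙ ⟦ f ⟧ᵉ
    ⟦ e ⁻¹ᵉ  ⟧ᵉ = ⟦ e ⟧ᵉ ⁻¹

    toWord : Expr n → List (Letter m)
    toWord (var i)  = word i
    toWord εᵉ       = []
    toWord (e ∙ᵉ f) = toWord e ++ toWord f
    toWord (e ⁻¹ᵉ)  = invert (toWord e)

    infix 4 _≐_
    _≐_ : Expr n → Expr n → Set
    e ≐ f = reduce (toWord e) ≡ reduce (toWord f)

    module _ (word-sound : ∀ i → eval (word i) ≈ ρ i) where

      eval-toWord : ∀ e → eval (toWord e) ≈ ⟦ e ⟧ᵉ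
      eval-toWord (var i)  = word-sound i
      eval-toWord εᵉ       = ≈-refl
      eval-toWord (e ∙ᵉ f) = trans (eval-++ (toWord e) (toWord f)) (∙-cong (eval-toWord e) (eval-toWord f))
      eval-toWord (e ⁻¹ᵉ)  = trans (eval-invert (toWord e)) (⁻¹-cong (eval-toWord e))

      solve : ∀ e f → e ≐ f → ⟦ e ⟧ᵉ ≈ ⟦ f ⟧ᵉ
      solve e f eq = trans (sym (eval-toWord e))
                           (trans (reduce-≡⇒eval-≈ (toWord e) (toWord f) eq) (eval-toWord f))

module FreeGroupSolver {c ℓ} (G : Group c ℓ) {n} (xs : Vec (Group.Carrier G) n) where
  open Group G using (_≈_; ε; identityˡ; identityʳ)

  generator : Fin n → List (Letter n)
  generator i = gen⁺ i ∷ []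

  open Solver G (lookup xs) ε (identityˡ ε) (lookup xs) generator public using (⟦_⟧ᵉ; _≐_)

  solve : ∀ e f → e ≐ f → ⟦ e ⟧ᵉ ≈ ⟦ f ⟧ᵉ
  solve = Solver.solve G (lookup xs) ε (identityˡ ε) (lookup xs) generator (λ _ → identityʳ _)

module Conjugation {c ℓ} (G : Group c ℓ) where
  open Group G renaming (refl to ≈-refl)
  open SetoidReasoning setoid
  private module Free = FreeGroupSolver G

  infixl 9 _^_
  _^_ : Carrier → Carrier → Carrier
  _^_ = Defs._^_ G

  ^-cong : ∀ {x y g h} → x ≈ y → g ≈ h → x ^ g ≈ y ^ h
  ^-cong x≈y g≈h = ∙-cong (∙-cong (⁻¹-cong g≈h) x≈y) g≈h

  ^-identityʳ : ∀ x → x ^ ε ≈ x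
  ^-identityʳ x = Free.solve (x ∷ []) (v₀ ^ᵉ εᵉ) v₀ refl

  ^-∙ : ∀ x g h → x ^ g ^ h ≈ x ^ (g ∙ h)
  ^-∙ x g h = Free.solve (x ∷ g ∷ h ∷ []) (v₀ ^ᵉ v₁ ^ᵉ v₂) (v₀ ^ᵉ (v₁ ∙ᵉ v₂)) refl

  ^-inverse : ∀ x g → x ^ g ^ (g ⁻¹) ≈ x
  ^-inverse x g = Free.solve (x ∷ g ∷ []) (v₀ ^ᵉ v₁ ^ᵉ (v₁ ⁻¹ᵉ)) v₀ refl

  ^-injective : ∀ {x y g} → x ^ g ≈ y ^ g → x ≈ y
  ^-injective {x} {y} {g} eq = begin
    x               ≈⟨ sym (^-inverse x g) ⟩
    x ^ g ^ (g ⁻¹)  ≈⟨ ^-cong eq ≈-refl ⟩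
    y ^ g ^ (g ⁻¹)  ≈⟨ ^-inverse y g ⟩
    y               ∎

  ^-equivariant : ∀ x y z g → (x ^ (y ∙ z)) ^ g ≈ (x ^ g) ^ (y ^ g ∙ z ^ g)
  ^-equivariant x y z g =
    Free.solve (x ∷ y ∷ z ∷ g ∷ []) (v₀ ^ᵉ (v₁ ∙ᵉ v₂) ^ᵉ v₃) (v₀ ^ᵉ v₃ ^ᵉ (v₁ ^ᵉ v₃ ∙ᵉ v₂ ^ᵉ v₃)) refl

  fixed⇒commutes : ∀ {x g} → x ≈ x ^ g → g ∙ x ≈ x ∙ g
  fixed⇒commutes {x} {g} x≈xᵍ = trans (∙-congˡ x≈xᵍ) (Free.solve (x ∷ g ∷ []) (v₁ ∙ᵉ v₀ ^ᵉ v₁) (v₀ ∙ᵉ v₁) refl)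

  Conj-refl : ∀ t → Conj G t t
  Conj-refl t = ε , sym (^-identityʳ _) , sym (^-identityʳ _) , sym (^-identityʳ _) , sym (^-identityʳ _)

  Conj-sym : ∀ {t u} → Conj G t u → Conj G u t
  Conj-sym (g , e₁ , e₂ , e₃ , e₄) = g ⁻¹ , back e₁ , back e₂ , back e₃ , back e₄
    where
      back : ∀ {x y} → y ≈ x ^ g → x ≈ y ^ (g ⁻¹)
      back {x} y≈xᵍ = trans (sym (^-inverse x g)) (^-cong (sym y≈xᵍ) ≈-refl)

  Conj-trans : ∀ {t u v} → Conj G t u → Conj G u v → Conj G t v
  Conj-trans (g , e₁ , e₂ , e₃ , e₄) (h , f₁ , f₂ , f₃ , f₄) = g ∙ h , then e₁ f₁ , then e₂ f₂ , then e₃ f₃ , then e₄ f₄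
    where
      then : ∀ {x y z} → y ≈ x ^ g → z ≈ y ^ h → z ≈ x ^ (g ∙ h)
      then {x} y≈xᵍ z≈yʰ = trans z≈yʰ (trans (^-cong y≈xᵍ ≈-refl) (^-∙ x g h))

  -- Each act₁ⱼ replaces a component x by x ^ (y ∙ z), for two other components y and z.
  ^-resp : ∀ {g x y z x′ y′ z′} → x′ ≈ x ^ g → y′ ≈ y ^ g → z′ ≈ z ^ g →
           x′ ^ (y′ ∙ z′) ≈ (x ^ (y ∙ z)) ^ g
  ^-resp {g} {x} {y} {z} x′≈ y′≈ z′≈ = trans (^-cong x′≈ (∙-cong y′≈ z′≈)) (sym (^-equivariant x y z g))

  ^-reflect : ∀ {g x y z x′ y′ z′} → y′ ≈ y ^ g → z′ ≈ z ^ g →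
              x′ ^ (y′ ∙ z′) ≈ (x ^ (y ∙ z)) ^ g → x′ ≈ x ^ g
  ^-reflect y′≈ z′≈ eq = ^-injective (trans eq (sym (^-resp ≈-refl y′≈ z′≈)))

  act₁₂-resp : ∀ {t u} → Conj G t u → Conj G (act₁₂ G t) (act₁₂ G u)
  act₁₂-resp (g , e₁ , e₂ , e₃ , e₄) = g , ^-resp e₁ e₃ e₄ , ^-resp e₂ e₃ e₄ , e₃ , e₄

  act₁₃-resp : ∀ {t u} → Conj G t u → Conj G (act₁₃ G t) (act₁₃ G u)
  act₁₃-resp (g , e₁ , e₂ , e₃ , e₄) = g , ^-resp e₁ e₂ e₄ , e₂ , ^-resp e₃ e₄ e₂ , e₄

  act₁₄-resp : ∀ {t u} → Conj G t u → Conj G (act₁₄ G t) (act₁₄ G u)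
  act₁₄-resp (g , e₁ , e₂ , e₃ , e₄) = g , ^-resp e₁ e₂ e₃ , e₂ , e₃ , ^-resp e₄ e₂ e₃

  act₁₂-reflect : ∀ {t u} → Conj G (act₁₂ G t) (act₁₂ G u) → Conj G t u
  act₁₂-reflect (g , e₁ , e₂ , e₃ , e₄) = g , ^-reflect e₃ e₄ e₁ , ^-reflect e₃ e₄ e₂ , e₃ , e₄

  act₁₃-reflect : ∀ {t u} → Conj G (act₁₃ G t) (act₁₃ G u) → Conj G t u
  act₁₃-reflect (g , e₁ , e₂ , e₃ , e₄) = g , ^-reflect e₂ e₄ e₁ , e₂ , ^-reflect e₄ e₂ e₃ , e₄

  act₁₄-reflect : ∀ {t u} → Conj G (act₁₄ G t) (act₁₄ G u) → Conj G t u
  act₁₄-reflect (g , e₁ , e₂ , e₃ , e₄) = g , ^-reflect e₂ e₃ e₁ , e₂ , e₃ , ^-reflect e₂ e₃ e₄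

IdOrSwap : (Fin 2 → Fin 2) → Set
IdOrSwap q = (q ≗ₚ id) ⊎ (q ≗ₚ swap2)

isId : IdOrSwap id
isId = inj₁ λ _ → refl

isSwap : IdOrSwap swap2
isSwap = inj₂ λ _ → refl

swap2-involutive : ∀ i → swap2 (swap2 i) ≡ i
swap2-involutive zero       = refl
swap2-involutive (suc zero) = refl

IdOrSwap-involutive : ∀ {p} → IdOrSwap p → ∀ i → p (p i) ≡ i
IdOrSwap-involutive {p} (inj₁ p≗id)    i = ≡.trans (p≗id (p i)) (p≗id i)
IdOrSwap-involutive {p} (inj₂ p≗swap2) i =
  ≡.trans (p≗swap2 (p i)) (≡.trans (cong swap2 (p≗swap2 i)) (swap2-involutive i))

IdOrSwap-∘ : ∀ {p q} → IdOrSwap p → IdOrSwap q → IdOrSwap (p ∘ q)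
IdOrSwap-∘ {q = q} (inj₁ p≗id) (inj₁ q≗id) = inj₁ λ i → ≡.trans (p≗id (q i)) (q≗id i)
IdOrSwap-∘ {q = q} (inj₁ p≗id) (inj₂ q≗sw) = inj₂ λ i → ≡.trans (p≗id (q i)) (q≗sw i)
IdOrSwap-∘ {q = q} (inj₂ p≗sw) (inj₁ q≗id) = inj₂ λ i → ≡.trans (p≗sw (q i)) (cong swap2 (q≗id i))
IdOrSwap-∘ {q = q} (inj₂ p≗sw) (inj₂ q≗sw) =
  inj₁ λ i → ≡.trans (p≗sw (q i)) (≡.trans (cong swap2 (q≗sw i)) (swap2-involutive i))

InGen⇒IdOrSwap : ∀ {p₁₂ p₁₃ p₁₄} → IdOrSwap p₁₂ → IdOrSwap p₁₃ → IdOrSwap p₁₄ →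
                 ∀ q → InGen p₁₂ p₁₃ p₁₄ q → IdOrSwap q
InGen⇒IdOrSwap h₁₂ h₁₃ h₁₄ _ gen-id     = isId
InGen⇒IdOrSwap h₁₂ h₁₃ h₁₄ _ (gen-12 q) = IdOrSwap-∘ h₁₂ (InGen⇒IdOrSwap h₁₂ h₁₃ h₁₄ _ q)
InGen⇒IdOrSwap h₁₂ h₁₃ h₁₄ _ (gen-13 q) = IdOrSwap-∘ h₁₃ (InGen⇒IdOrSwap h₁₂ h₁₃ h₁₄ _ q)
InGen⇒IdOrSwap h₁₂ h₁₃ h₁₄ _ (gen-14 q) = IdOrSwap-∘ h₁₄ (InGen⇒IdOrSwap h₁₂ h₁₃ h₁₄ _ q)

module PairOrbit {c ℓ} (G : Group c ℓ) (e : Fin 2 → Sys G) {p₁₂ p₁₃ p₁₄ : Fin 2 → Fin 2}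
  (p₁₂-inv : IdOrSwap p₁₂) (p₁₃-inv : IdOrSwap p₁₃) (p₁₄-inv : IdOrSwap p₁₄)
  (I₁₂ : Induces G (act₁₂ G) e p₁₂) (I₁₃ : Induces G (act₁₃ G) e p₁₃) (I₁₄ : Induces G (act₁₄ G) e p₁₄)
  where
  open Conjugation G

  InPair : Sys G → Set _
  InPair t = Σ (Fin 2) λ i → Conj G t (e i)

  forward : ∀ {act p} → (∀ {t u} → Conj G t u → Conj G (act t) (act u)) →
            Induces G act e p → ∀ {t} → InPair t → InPair (act t)
  forward {p = p} act-resp I (i , t∼eᵢ) = p i , Conj-trans (act-resp t∼eᵢ) (I i)

  -- p is an involution, so act (e (p i)) ∼ e i.
  backward : ∀ {act p} → (∀ {t u} → Conj G (act t) (act u) → Conj G t u) → IdOrSwap p →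
             Induces G act e p → ∀ {u} → InPair (act u) → InPair u
  backward {act} {p} act-reflect p-inv I (i , actu∼eᵢ) =
    p i , act-reflect (Conj-trans actu∼eᵢ (Conj-sym (subst (λ j → Conj G (act (e (p i))) (e j))
                                                       (IdOrSwap-involutive p-inv i) (I (p i)))))

  step : ∀ {t u} → Step G t u → InPair t → InPair u
  step (st-conj t∼u) (i , t∼eᵢ) = i , Conj-trans (Conj-sym t∼u) t∼eᵢ
  step (st-12 _) = forward act₁₂-resp I₁₂
  step (st-13 _) = forward act₁₃-resp I₁₃
  step (st-14 _) = forward act₁₄-resp I₁₄

  step⁻¹ : ∀ {t u} → Step G u t → InPair t → InPair u
  step⁻¹ (st-conj u∼t) (i , t∼eᵢ) = i , Conj-trans u∼t t∼eᵢ
  step⁻¹ (st-12 _) = backward act₁₂-reflect p₁₂-inv I₁₂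
  step⁻¹ (st-13 _) = backward act₁₃-reflect p₁₃-inv I₁₃
  step⁻¹ (st-14 _) = backward act₁₄-reflect p₁₄-inv I₁₄

  SameOrbit-InPair : ∀ {t u} → SameOrbit G t u → InPair t → InPair u
  SameOrbit-InPair []*          q = q
  SameOrbit-InPair (fwd s ◅ ss) q = SameOrbit-InPair ss (step s q)
  SameOrbit-InPair (bwd s ◅ ss) q = SameOrbit-InPair ss (step⁻¹ s q)

  orbit⊆pair : ∀ t → SameOrbit G (e zero) t → Conj G t (e zero) ⊎ Conj G t (e (suc zero))
  orbit⊆pair t e₀∼t with SameOrbit-InPair e₀∼t (zero , Conj-refl (e zero))
  ... | zero     , t∼e₀ = inj₁ t∼e₀
  ... | suc zero , t∼e₁ = inj₂ t∼e₁

module _ {c ℓ} (G : Group c ℓ) where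
  open Group G renaming (refl to ≈-refl)

  module Free = FreeGroupSolver G
  open SetoidReasoning setoid

  commutes-⁻¹ : ∀ {z x} → z ∙ x ≈ x ∙ z → z ∙ x ⁻¹ ≈ x ⁻¹ ∙ z
  commutes-⁻¹ {z} {x} zx≈xz = begin
    z ∙ x ⁻¹                ≈⟨ Free.solve (z ∷ x ∷ []) (v₀ ∙ᵉ v₁ ⁻¹ᵉ) (v₁ ⁻¹ᵉ ∙ᵉ (v₁ ∙ᵉ v₀) ∙ᵉ v₁ ⁻¹ᵉ) refl ⟩
    x ⁻¹ ∙ (x ∙ z) ∙ x ⁻¹   ≈⟨ ∙-congʳ (∙-congˡ (sym zx≈xz)) ⟩
    x ⁻¹ ∙ (z ∙ x) ∙ x ⁻¹   ≈⟨ Free.solve (z ∷ x ∷ []) (v₁ ⁻¹ᵉ ∙ᵉ (v₀ ∙ᵉ v₁) ∙ᵉ v₁ ⁻¹ᵉ) (v₁ ⁻¹ᵉ ∙ᵉ v₀) refl ⟩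
    x ⁻¹ ∙ z                ∎

  commutes-∙ : ∀ {z x y} → z ∙ x ≈ x ∙ z → z ∙ y ≈ y ∙ z → z ∙ (x ∙ y) ≈ x ∙ y ∙ z
  commutes-∙ {z} {x} {y} zx≈xz zy≈yz = begin
    z ∙ (x ∙ y)  ≈⟨ sym (assoc z x y) ⟩
    z ∙ x ∙ y    ≈⟨ ∙-congʳ zx≈xz ⟩
    x ∙ z ∙ y    ≈⟨ assoc x z y ⟩
    x ∙ (z ∙ y)  ≈⟨ ∙-congˡ zy≈yz ⟩
    x ∙ (y ∙ z)  ≈⟨ sym (assoc x y z) ⟩
    x ∙ y ∙ z    ∎

  commutes-⟨⟩ : ∀ {S z} → (∀ {s} → S s → z ∙ s ≈ s ∙ z) → ∀ {x} → ⟨ G ⟩ S x → z ∙ x ≈ x ∙ z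
  commutes-⟨⟩ comm (gen s)    = comm s
  commutes-⟨⟩ comm unit       = trans (identityʳ _) (sym (identityˡ _))
  commutes-⟨⟩ comm (mul x y)  = commutes-∙ (commutes-⟨⟩ comm x) (commutes-⟨⟩ comm y)
  commutes-⟨⟩ comm (inv x)    = commutes-⁻¹ (commutes-⟨⟩ comm x)
  commutes-⟨⟩ comm (resp e x) = trans (∙-congˡ (sym e)) (trans (commutes-⟨⟩ comm x) (∙-congʳ e))

  ⟨⟩-mono : ∀ {S T : Carrier → Set ℓ} → (∀ {x} → S x → T x) → ∀ {x} → ⟨ G ⟩ S x → ⟨ G ⟩ T x
  ⟨⟩-mono f (gen s)    = gen (f s)
  ⟨⟩-mono f unit       = unit
  ⟨⟩-mono f (mul x y)  = mul (⟨⟩-mono f x) (⟨⟩-mono f y)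
  ⟨⟩-mono f (inv x)    = inv (⟨⟩-mono f x)
  ⟨⟩-mono f (resp e x) = resp e (⟨⟩-mono f x)

  first-second : ∀ {a b c′ d x : Carrier} →
                   Gen2 G a b x → Gen4 G ⟦ a , b , c′ , d ⟧ x
  first-second (inj₁ x≈a) = inj₁ x≈a
  first-second (inj₂ x≈b) = inj₂ (inj₁ x≈b)

  first-third : ∀ {a b c′ d x : Carrier} →
                  Gen2 G a c′ x → Gen4 G ⟦ a , b , c′ , d ⟧ x
  first-third (inj₁ x≈a)  = inj₁ x≈a
  first-third (inj₂ x≈c′) = inj₂ (inj₂ (inj₁ x≈c′))

  module TwoGenerated (σ₁ σ₂ : Carrier)
    (generated : Generates G (Gen2 G σ₁ σ₂)) (trivial-center : TrivialCenter G)
    (order2 : HasOrder2 G (σ₁ ∙ σ₂)) where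

    open Conjugation G

    central⇒ε : ∀ z → z ∙ σ₁ ≈ σ₁ ∙ z → z ∙ σ₂ ≈ σ₂ ∙ z → z ≈ ε
    central⇒ε z zσ₁≈σ₁z zσ₂≈σ₂z = trivial-center z λ x → commutes-⟨⟩ comm (generated x)
      where
        comm : ∀ {s} → Gen2 G σ₁ σ₂ s → z ∙ s ≈ s ∙ z
        comm (inj₁ s≈σ₁) = trans (∙-congˡ s≈σ₁) (trans zσ₁≈σ₁z (∙-congʳ (sym s≈σ₁)))
        comm (inj₂ s≈σ₂) = trans (∙-congˡ s≈σ₂) (trans zσ₂≈σ₂z (∙-congʳ (sym s≈σ₂)))

    ^-trivial : ∀ {g} → σ₁ ≈ σ₁ ^ g → σ₂ ≈ σ₂ ^ g → ∀ x → x ^ g ≈ x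
    ^-trivial fix₁ fix₂ x =
      trans (^-cong ≈-refl (central⇒ε _ (fixed⇒commutes fix₁) (fixed⇒commutes fix₂))) (^-identityʳ x)

    σ₁σ₂≉σ₂σ₁ : ¬ (σ₁ ∙ σ₂ ≈ σ₂ ∙ σ₁)
    σ₁σ₂≉σ₂σ₁ comm = proj₁ order2 (central⇒ε (σ₁ ∙ σ₂)
      (trans (assoc _ _ _) (∙-congˡ (sym comm)))
      (trans (∙-congʳ comm) (assoc _ _ _)))

    -- σ₂ is encoded as the word σ₁⁻¹τ, where τ = σ₁σ₂.
    word : Fin 2 → List (Letter 1)
    word zero       = gen⁺ zero ∷ []
    word (suc zero) = gen⁻ zero ∷ τ ∷ []

    ρ : Fin 2 → Carrier
    ρ = lookup (σ₁ ∷ σ₂ ∷ [])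

    open Solver G (λ _ → σ₁) (σ₁ ∙ σ₂) (proj₂ order2) ρ word using (⟦_⟧ᵉ; _≐_; eval)

    word-sound : ∀ i → eval (word i) ≈ ρ i
    word-sound zero       = identityʳ σ₁
    word-sound (suc zero) = Free.solve (σ₁ ∷ σ₂ ∷ []) (v₀ ⁻¹ᵉ ∙ᵉ (v₀ ∙ᵉ v₁ ∙ᵉ εᵉ)) v₁ refl

    solve : ∀ e f → e ≐ f → ⟦ e ⟧ᵉ ≈ ⟦ f ⟧ᵉ
    solve = Solver.solve G (λ _ → σ₁) (σ₁ ∙ σ₂) (proj₂ order2) ρ word word-sound

    σ₁ᵉ σ₂ᵉ τᵉ : Expr 2
    σ₁ᵉ = v₀
    σ₂ᵉ = v₁
    τᵉ  = σ₁ᵉ ∙ᵉ σ₂ᵉ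

    record Sysᵉ : Set where
      constructor ⟪_,_,_,_⟫
      field x₁ x₂ x₃ x₄ : Expr 2

    ⟦_⟧ₛ : Sysᵉ → Sys G
    ⟦ ⟪ x₁ , x₂ , x₃ , x₄ ⟫ ⟧ₛ = ⟦ ⟦ x₁ ⟧ᵉ , ⟦ x₂ ⟧ᵉ , ⟦ x₃ ⟧ᵉ , ⟦ x₄ ⟧ᵉ ⟧

    act₁₂ᵉ act₁₃ᵉ act₁₄ᵉ : Sysᵉ → Sysᵉ
    act₁₂ᵉ ⟪ x₁ , x₂ , x₃ , x₄ ⟫ = ⟪ x₁ ^ᵉ (x₃ ∙ᵉ x₄) , x₂ ^ᵉ (x₃ ∙ᵉ x₄) , x₃ , x₄ ⟫
    act₁₃ᵉ ⟪ x₁ , x₂ , x₃ , x₄ ⟫ = ⟪ x₁ ^ᵉ (x₂ ∙ᵉ x₄) , x₂ , x₃ ^ᵉ (x₄ ∙ᵉ x₂) , x₄ ⟫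
    act₁₄ᵉ ⟪ x₁ , x₂ , x₃ , x₄ ⟫ = ⟪ x₁ ^ᵉ (x₂ ∙ᵉ x₃) , x₂ , x₃ , x₄ ^ᵉ (x₂ ∙ᵉ x₃) ⟫

    conj-by : (s s′ : Sysᵉ) (g : Expr 2) → let open Sysᵉ in
              x₁ s′ ≐ x₁ s ^ᵉ g → x₂ s′ ≐ x₂ s ^ᵉ g → x₃ s′ ≐ x₃ s ^ᵉ g → x₄ s′ ≐ x₄ s ^ᵉ g →
              Conj G ⟦ s ⟧ₛ ⟦ s′ ⟧ₛ
    conj-by ⟪ x₁ , x₂ , x₃ , x₄ ⟫ ⟪ y₁ , y₂ , y₃ , y₄ ⟫ g eq₁ eq₂ eq₃ eq₄ =
      ⟦ g ⟧ᵉ , solve y₁ (x₁ ^ᵉ g) eq₁ , solve y₂ (x₂ ^ᵉ g) eq₂ , solve y₃ (x₃ ^ᵉ g) eq₃ , solve y₄ (x₄ ^ᵉ g) eq₄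

    product-ε : (s : Sysᵉ) → let open Sysᵉ in x₁ s ∙ᵉ x₂ s ∙ᵉ x₃ s ∙ᵉ x₄ s ≐ εᵉ →
                s₁ ⟦ s ⟧ₛ ∙ s₂ ⟦ s ⟧ₛ ∙ s₃ ⟦ s ⟧ₛ ∙ s₄ ⟦ s ⟧ₛ ≈ ε
    product-ε ⟪ x₁ , x₂ , x₃ , x₄ ⟫ = solve (x₁ ∙ᵉ x₂ ∙ᵉ x₃ ∙ᵉ x₄) εᵉ

    module Z₁ where
      E₁ E₂ : Sysᵉ
      E₁ = ⟪ σ₁ᵉ , σ₁ᵉ , σ₂ᵉ , σ₁ᵉ ∙ᵉ σ₂ᵉ ∙ᵉ σ₁ᵉ ⁻¹ᵉ ⟫
      E₂ = ⟪ σ₁ᵉ , σ₂ᵉ ∙ᵉ σ₁ᵉ ∙ᵉ σ₂ᵉ ⁻¹ᵉ , σ₂ᵉ , σ₂ᵉ ⟫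

      e : Fin 2 → Sys G
      e = pair G ⟦ E₁ ⟧ₛ ⟦ E₂ ⟧ₛ

      I₁₂ : Induces G (act₁₂ G) e id
      I₁₂ zero       = conj-by (act₁₂ᵉ E₁) E₁ εᵉ refl refl refl refl
      I₁₂ (suc zero) = conj-by (act₁₂ᵉ E₂) E₂ (τᵉ ∙ᵉ σ₁ᵉ ∙ᵉ τᵉ ∙ᵉ σ₁ᵉ) refl refl refl refl

      I₁₃ : Induces G (act₁₃ G) e swap2
      I₁₃ zero       = conj-by (act₁₃ᵉ E₁) E₂ (σ₁ᵉ ∙ᵉ τᵉ ∙ᵉ σ₁ᵉ) refl refl refl refl
      I₁₃ (suc zero) = conj-by (act₁₃ᵉ E₂) E₁ (σ₁ᵉ ⁻¹ᵉ ∙ᵉ τᵉ ∙ᵉ σ₁ᵉ ⁻¹ᵉ) refl refl refl refl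

      I₁₄ : Induces G (act₁₄ G) e swap2
      I₁₄ zero       = conj-by (act₁₄ᵉ E₁) E₂ (τᵉ ∙ᵉ σ₁ᵉ) refl refl refl refl
      I₁₄ (suc zero) = conj-by (act₁₄ᵉ E₂) E₁ (σ₁ᵉ ⁻¹ᵉ ∙ᵉ τᵉ) refl refl refl refl

      generating : ∀ i → IsGenSys G (e i)
      generating zero       = (λ x → ⟨⟩-mono first-third (generated x)) , product-ε E₁ refl
      generating (suc zero) = (λ x → ⟨⟩-mono first-third (generated x)) , product-ε E₂ refl

      distinct : ¬ Conj G (e zero) (e (suc zero))
      distinct (g , fix₁ , σ₂σ₁σ₂⁻¹≈σ₁ᵍ , fix₂ , _) = σ₁σ₂≉σ₂σ₁ (sym (begin
        σ₂ ∙ σ₁                 ≈⟨ solve (σ₂ᵉ ∙ᵉ σ₁ᵉ) (σ₂ᵉ ∙ᵉ σ₁ᵉ ∙ᵉ σ₂ᵉ ⁻¹ᵉ ∙ᵉ σ₂ᵉ) refl ⟩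
        σ₂ ∙ σ₁ ∙ σ₂ ⁻¹ ∙ σ₂    ≈⟨ ∙-congʳ (trans σ₂σ₁σ₂⁻¹≈σ₁ᵍ (^-trivial fix₁ fix₂ σ₁)) ⟩
        σ₁ ∙ σ₂                 ∎))

      claim : OrbitClaim G e id swap2 swap2
      claim = generating , distinct , (fwd (st-13 _) ◅ fwd (st-conj (I₁₃ zero)) ◅ []*)
            , PairOrbit.orbit⊆pair G e isId isSwap isSwap I₁₂ I₁₃ I₁₄ , I₁₂ , I₁₃ , I₁₄
            , (InGen⇒IdOrSwap isId isSwap isSwap , swap2 , gen-13 gen-id , λ _ → refl) , refl

    module Z₂ where
      E₃ E₄ : Sysᵉ
      E₃ = ⟪ σ₁ᵉ , σ₂ᵉ , σ₁ᵉ , σ₂ᵉ ⟫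
      E₄ = ⟪ σ₁ᵉ , σ₂ᵉ , σ₂ᵉ ⁻¹ᵉ ∙ᵉ σ₁ᵉ ∙ᵉ σ₂ᵉ , σ₁ᵉ ∙ᵉ σ₂ᵉ ∙ᵉ σ₁ᵉ ⁻¹ᵉ ⟫

      e : Fin 2 → Sys G
      e = pair G ⟦ E₃ ⟧ₛ ⟦ E₄ ⟧ₛ

      I₁₂ : Induces G (act₁₂ G) e swap2
      I₁₂ zero       = conj-by (act₁₂ᵉ E₃) E₄ τᵉ refl refl refl refl
      I₁₂ (suc zero) = conj-by (act₁₂ᵉ E₄) E₃ τᵉ refl refl refl refl

      I₁₃ : Induces G (act₁₃ G) e id
      I₁₃ zero       = conj-by (act₁₃ᵉ E₃) E₃ (τᵉ ∙ᵉ σ₁ᵉ ∙ᵉ τᵉ ∙ᵉ σ₁ᵉ) refl refl refl refl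
      I₁₃ (suc zero) = conj-by (act₁₃ᵉ E₄) E₄ εᵉ refl refl refl refl

      I₁₄ : Induces G (act₁₄ G) e swap2
      I₁₄ zero       = conj-by (act₁₄ᵉ E₃) E₄ (σ₁ᵉ ⁻¹ᵉ ∙ᵉ τᵉ) refl refl refl refl
      I₁₄ (suc zero) = conj-by (act₁₄ᵉ E₄) E₃ (τᵉ ∙ᵉ σ₁ᵉ) refl refl refl refl

      generating : ∀ i → IsGenSys G (e i)
      generating zero       = (λ x → ⟨⟩-mono first-second (generated x)) , product-ε E₃ refl
      generating (suc zero) = (λ x → ⟨⟩-mono first-second (generated x)) , product-ε E₄ refl

      distinct : ¬ Conj G (e zero) (e (suc zero))
      distinct (g , fix₁ , fix₂ , σ₂⁻¹σ₁σ₂≈σ₁ᵍ , _) = σ₁σ₂≉σ₂σ₁ (begin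
        σ₁ ∙ σ₂                 ≈⟨ solve (σ₁ᵉ ∙ᵉ σ₂ᵉ) (σ₂ᵉ ∙ᵉ (σ₂ᵉ ⁻¹ᵉ ∙ᵉ σ₁ᵉ ∙ᵉ σ₂ᵉ)) refl ⟩
        σ₂ ∙ (σ₂ ⁻¹ ∙ σ₁ ∙ σ₂)  ≈⟨ ∙-congˡ (trans σ₂⁻¹σ₁σ₂≈σ₁ᵍ (^-trivial fix₁ fix₂ σ₁)) ⟩
        σ₂ ∙ σ₁                 ∎)

      claim : OrbitClaim G e swap2 id swap2
      claim = generating , distinct , (fwd (st-12 _) ◅ fwd (st-conj (I₁₂ zero)) ◅ []*)
            , PairOrbit.orbit⊆pair G e isSwap isId isSwap I₁₂ I₁₃ I₁₄ , I₁₂ , I₁₃ , I₁₄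
            , (InGen⇒IdOrSwap isSwap isId isSwap , swap2 , gen-12 gen-id , λ _ → refl) , refl

    module Z₃ where
      E₅ E₆ : Sysᵉ
      E₅ = ⟪ σ₁ᵉ , σ₂ᵉ , σ₂ᵉ , σ₂ᵉ ⁻¹ᵉ ∙ᵉ σ₁ᵉ ∙ᵉ σ₂ᵉ ⟫
      E₆ = ⟪ σ₁ᵉ , σ₂ᵉ , σ₁ᵉ ∙ᵉ σ₂ᵉ ∙ᵉ σ₁ᵉ ⁻¹ᵉ , σ₁ᵉ ⟫

      e : Fin 2 → Sys G
      e = pair G ⟦ E₅ ⟧ₛ ⟦ E₆ ⟧ₛ

      I₁₂ : Induces G (act₁₂ G) e swap2
      I₁₂ zero       = conj-by (act₁₂ᵉ E₅) E₆ τᵉ refl refl refl refl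
      I₁₂ (suc zero) = conj-by (act₁₂ᵉ E₆) E₅ τᵉ refl refl refl refl

      I₁₃ : Induces G (act₁₃ G) e swap2
      I₁₃ zero       = conj-by (act₁₃ᵉ E₅) E₆ (τᵉ ∙ᵉ σ₁ᵉ) refl refl refl refl
      I₁₃ (suc zero) = conj-by (act₁₃ᵉ E₆) E₅ (σ₁ᵉ ⁻¹ᵉ ∙ᵉ τᵉ) refl refl refl refl

      I₁₄ : Induces G (act₁₄ G) e id
      I₁₄ zero       = conj-by (act₁₄ᵉ E₅) E₅ (τᵉ ∙ᵉ σ₁ᵉ ∙ᵉ τᵉ ∙ᵉ σ₁ᵉ) refl refl refl refl
      I₁₄ (suc zero) = conj-by (act₁₄ᵉ E₆) E₆ εᵉ refl refl refl refl

      generating : ∀ i → IsGenSys G (e i)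
      generating zero       = (λ x → ⟨⟩-mono first-second (generated x)) , product-ε E₅ refl
      generating (suc zero) = (λ x → ⟨⟩-mono first-second (generated x)) , product-ε E₆ refl

      distinct : ¬ Conj G (e zero) (e (suc zero))
      distinct (g , fix₁ , fix₂ , σ₁σ₂σ₁⁻¹≈σ₂ᵍ , _) = σ₁σ₂≉σ₂σ₁ (begin
        σ₁ ∙ σ₂                 ≈⟨ solve (σ₁ᵉ ∙ᵉ σ₂ᵉ) (σ₁ᵉ ∙ᵉ σ₂ᵉ ∙ᵉ σ₁ᵉ ⁻¹ᵉ ∙ᵉ σ₁ᵉ) refl ⟩
        σ₁ ∙ σ₂ ∙ σ₁ ⁻¹ ∙ σ₁    ≈⟨ ∙-congʳ (trans σ₁σ₂σ₁⁻¹≈σ₂ᵍ (^-trivial fix₁ fix₂ σ₂)) ⟩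
        σ₂ ∙ σ₁                 ∎)

      claim : OrbitClaim G e swap2 swap2 id
      claim = generating , distinct , (fwd (st-12 _) ◅ fwd (st-conj (I₁₂ zero)) ◅ []*)
            , PairOrbit.orbit⊆pair G e isSwap isSwap isId I₁₂ I₁₃ I₁₄ , I₁₂ , I₁₃ , I₁₄
            , (InGen⇒IdOrSwap isSwap isSwap isId , swap2 , gen-12 gen-id , λ _ → refl) , refl

theorem2 : ∀ {c ℓ : Level} (G : Group c ℓ) → let open Group G in
    Finite G → Nontrivial G → TrivialCenter G →
    (σ₁ σ₂ : Carrier) → Generates G (Gen2 G σ₁ σ₂) → HasOrder2 G (σ₁ ∙ σ₂) →
    OrbitClaim G
      (pair G ⟦ σ₁ , σ₁ , σ₂ , (σ₁ ∙ σ₂) ∙ σ₁ ⁻¹ ⟧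
              ⟦ σ₁ , (σ₂ ∙ σ₁) ∙ σ₂ ⁻¹ , σ₂ , σ₂ ⟧)
      id swap2 swap2
    × OrbitClaim G
      (pair G ⟦ σ₁ , σ₂ , σ₁ , σ₂ ⟧
              ⟦ σ₁ , σ₂ , (σ₂ ⁻¹ ∙ σ₁) ∙ σ₂ , (σ₁ ∙ σ₂) ∙ σ₁ ⁻¹ ⟧)
      swap2 id swap2
    × OrbitClaim G
      (pair G ⟦ σ₁ , σ₂ , σ₂ , (σ₂ ⁻¹ ∙ σ₁) ∙ σ₂ ⟧
              ⟦ σ₁ , σ₂ , (σ₁ ∙ σ₂) ∙ σ₁ ⁻¹ , σ₁ ⟧)
      swap2 swap2 id
theorem2 G _ _ trivial-center σ₁ σ₂ generated order2 = Z₁.claim , Z₂.claim , Z₃.claim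
  where open TwoGenerated G σ₁ σ₂ generated trivial-center order2
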